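{- The function $r_{\mathrm{OPT}}$ is $2$-quasimultiplicative; specifically, for all nonnegative integers $a,b,k$ with $b<2^k$, $$r_{\mathrm{OPT}}(2^{k+3}a+b)=r_{\mathrm{OPT}}(a)\,r_{\mathrm{OPT}}(b).$$
   Context: For a nonnegative integer $n$, a $\{0,1,-1\}$-representation of $n$ is a finite digit sequence $(\varepsilon_i)$ with $\varepsilon_i\in\{0,1,-1\}$ and $n=\sum_i\varepsilon_i2^i$ (representations differing only by leading zeros are identified). It is optimal if its number of nonzero digits is minimal among all such representations of $n$. $r_{\mathrm{OPT}}(n)$ denotes the number of optimal $\{0,1,-1\}$-representations of $n$. A function $f$ is $2$-quasimultiplicative if there is a nonnegative integer $r$ with $f(2^{k+r}a+b)=f(a)f(b)$ whenever $0\le b<2^k$. -}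

module Defs where

open import Data.Nat using (ℕ; zero; suc; _+_; _*_; _≤_)
open import Data.Integer as ℤ using (ℤ; +_; -[1+_])
open import Data.List using (List; []; _∷_; length)
open import Data.List.Membership.Propositional using (_∈_)
open import Data.List.Relation.Unary.All using (All)
open import Data.List.Relation.Unary.Unique.Propositional using (Unique)
open import Data.Product using (Σ; _×_)
open import Relation.Binary.PropositionalEquality using (_≡_; _≢_)
open import Relation.Nullary using (¬_)

data Digit : Set where
  d0 d1 dm1 : Digit

digitVal : Digit → ℤ
digitVal d0  = + 0
digitVal d1  = + 1
digitVal dm1 = -[1+ 0 ]

-- a digit sequence, least significant digit first: (ε₀ ∷ ε₁ ∷ …)
DigitSeq : Set
DigitSeq = List Digit

value : DigitSeq → ℤ
value []       = + 0
value (e ∷ es) = digitVal e ℤ.+ (+ 2) ℤ.* value es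

weight : DigitSeq → ℕ
weight []         = 0
weight (d0 ∷ es)  = weight es
weight (d1 ∷ es)  = suc (weight es)
weight (dm1 ∷ es) = suc (weight es)

-- canonical form modulo leading zeros: the most significant digit is nonzero
-- (the empty sequence represents 0)
NoLeadingZero : DigitSeq → Set
NoLeadingZero []           = Data.Unit.⊤ where import Data.Unit
NoLeadingZero (e ∷ [])     = e ≢ d0
NoLeadingZero (e ∷ f ∷ es) = NoLeadingZero (f ∷ es)

IsRep : ℕ → DigitSeq → Set
IsRep n es = value es ≡ + n

IsOptRep : ℕ → DigitSeq → Set
IsOptRep n es =
  NoLeadingZero es × IsRep n es × ((fs : DigitSeq) → IsRep n fs → weight es ≤ weight fs)

-- rOPT n ≡ m : the set of optimal representations of n is finite with exactly m elements,
-- witnessed by a duplicate-free list enumerating exactly these representations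
ROpt : ℕ → ℕ → Set
ROpt n m = Σ (List DigitSeq) λ L →
  Unique L × length L ≡ m × All (IsOptRep n) L × ((es : DigitSeq) → IsOptRep n es → es ∈ L)

-- Cut a representation of 2^(k+3) a + b into its low k+3 digits T and the rest D. As
-- |value T| < 2^(k+3), the carry between the two parts is 0 or -1. Without carry, T represents b
-- and D represents a. With a borrow, value T = b - 2^(k+3) forces the top three digits of T to be
-- -1, so T has at least r + 2 nonzero digits, where r is the optimal weight of b, while D represents
-- a + 1 and so has at least s - 1, where s is the optimal weight of a: such a representation is
-- not optimal. Hence the optimal representations of 2^(k+3) a + b are exactly those of b, padded
-- to k+3 digits, followed by those of a. The optimal representations of each n are enumerated
-- along the binary expansion of n, by the parity of n.

module Submission where

open import Defs
open import Data.Nat as ℕ using (ℕ; zero; suc; _+_; _*_; _^_; _∸_; _⊓_; _≤_; _<_; z≤n; s≤s)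
import Data.Nat.Properties as ℕP
open import Data.Integer as ℤ using (ℤ; +_; -[1+_])
import Data.Integer.Properties as ℤP
open import Data.Integer.Tactic.RingSolver using (solve-∀)
open import Data.List using (List; []; _∷_; _++_; _∷ʳ_; length; take; drop; map; replicate; filter; cartesianProduct; initLast; _∷ʳ′_)
import Data.List.Properties as ListP
open import Data.List.Membership.Propositional using (_∈_)
open import Data.List.Relation.Unary.All as All using ([]; _∷_)
open import Data.List.Relation.Unary.Any using (here)
open import Data.List.Relation.Unary.AllPairs using ([]; _∷_)
open import Data.List.Relation.Unary.Unique.Propositional using (Unique)
import Data.List.Relation.Unary.Unique.Propositional.Properties as UniqueP
open import Data.List.Membership.Propositional.Properties using (∈-map⁺; ∈-map⁻; ∈-++⁺ˡ; ∈-++⁺ʳ; ∈-++⁻; ∈-filter⁺; ∈-filter⁻; ∈-cartesianProduct⁺; ∈-cartesianProduct⁻)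
open import Data.Product as Product using (Σ; _×_; _,_; proj₁; proj₂)
open import Data.Sum using (_⊎_; inj₁; inj₂)
open import Data.Empty using (⊥-elim)
open import Data.Unit using (tt)
open import Relation.Binary.PropositionalEquality
open import Relation.Nullary using (¬_; Dec)
open import Data.Nat.Induction using (<-rec)
import Data.Nat.Tactic.RingSolver as ℕSolver

-- Values and weights of digit sequences

two^ : ℕ → ℤ
two^ n = + (2 ^ n)

two^-suc : ∀ n → two^ (suc n) ≡ + 2 ℤ.* two^ n
two^-suc n = ℤP.pos-* 2 (2 ^ n)

two^-mono-≤ : ∀ {m n} → m ≤ n → two^ m ℤ.≤ two^ n
two^-mono-≤ m≤n = ℤ.+≤+ (ℕP.^-monoʳ-≤ 2 m≤n)

pos-2^*+ : ∀ K n m → + (2 ^ K * n + m) ≡ two^ K ℤ.* + n ℤ.+ + m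
pos-2^*+ K n m = trans (ℤP.pos-+ (2 ^ K * n) m) (cong (ℤ._+ + m) (ℤP.pos-* (2 ^ K) n))

+-pinned : ∀ {x y m n} → x + y ≡ m + n → m ≤ x → n ≤ y → x ≡ m × y ≡ n
+-pinned {x} {y} {m} {n} eq m≤x n≤y =
  ℕP.≤-antisym (ℕP.+-cancelʳ-≤ y x m (subst (_≤ m + y) (sym eq) (ℕP.+-monoʳ-≤ m n≤y))) m≤x ,
  ℕP.≤-antisym (ℕP.+-cancelˡ-≤ x y n (subst (_≤ x + n) (sym eq) (ℕP.+-monoˡ-≤ n m≤x))) n≤y

∷-value-shift : ∀ x {xs ys zs} n → value xs ≡ value ys ℤ.+ two^ n ℤ.* value zs →
                value (x ∷ xs) ≡ value (x ∷ ys) ℤ.+ two^ (suc n) ℤ.* value zs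
∷-value-shift x {xs} {ys} {zs} n eq = begin
  digitVal x ℤ.+ + 2 ℤ.* value xs
    ≡⟨ cong (λ v → digitVal x ℤ.+ + 2 ℤ.* v) eq ⟩
  digitVal x ℤ.+ + 2 ℤ.* (value ys ℤ.+ two^ n ℤ.* value zs)
    ≡⟨ shift (digitVal x) (value ys) (two^ n) (value zs) ⟩
  value (x ∷ ys) ℤ.+ (+ 2 ℤ.* two^ n) ℤ.* value zs
    ≡⟨ cong (λ p → value (x ∷ ys) ℤ.+ p ℤ.* value zs) (two^-suc n) ⟨
  value (x ∷ ys) ℤ.+ two^ (suc n) ℤ.* value zs ∎
  where
  open ≡-Reasoning
  shift : ∀ d v p w → d ℤ.+ + 2 ℤ.* (v ℤ.+ p ℤ.* w) ≡ (d ℤ.+ + 2 ℤ.* v) ℤ.+ (+ 2 ℤ.* p) ℤ.* w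
  shift = solve-∀

value-++ : ∀ xs ys → value (xs ++ ys) ≡ value xs ℤ.+ two^ (length xs) ℤ.* value ys
value-++ []       ys = sym (trans (ℤP.+-identityˡ _) (ℤP.*-identityˡ _))
value-++ (x ∷ xs) ys = ∷-value-shift x {xs ++ ys} {xs} {ys} (length xs) (value-++ xs ys)

value-∷ʳ : ∀ xs d → value (xs ∷ʳ d) ≡ value xs ℤ.+ two^ (length xs) ℤ.* digitVal d
value-∷ʳ xs d = trans (value-++ xs (d ∷ [])) (cong (λ v → value xs ℤ.+ two^ (length xs) ℤ.* v) (ℤP.+-identityʳ (digitVal d)))

value-take-drop : ∀ n xs → value xs ≡ value (take n xs) ℤ.+ two^ n ℤ.* value (drop n xs)
value-take-drop zero    xs       = sym (trans (ℤP.+-identityˡ _) (ℤP.*-identityˡ _))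
value-take-drop (suc n) []       = sym (trans (ℤP.+-identityˡ _) (ℤP.*-zeroʳ (two^ (suc n))))
value-take-drop (suc n) (x ∷ xs) = ∷-value-shift x {xs} {take n xs} {drop n xs} n (value-take-drop n xs)

weight-++ : ∀ xs ys → weight (xs ++ ys) ≡ weight xs + weight ys
weight-++ []         ys = refl
weight-++ (d0 ∷ xs)  ys = weight-++ xs ys
weight-++ (d1 ∷ xs)  ys = cong suc (weight-++ xs ys)
weight-++ (dm1 ∷ xs) ys = cong suc (weight-++ xs ys)

weight-take-drop : ∀ n xs → weight xs ≡ weight (take n xs) + weight (drop n xs)
weight-take-drop n xs = trans (cong weight (sym (ListP.take++drop≡id n xs))) (weight-++ (take n xs) (drop n xs))

length-∷ʳ : ∀ (xs : DigitSeq) d → length (xs ∷ʳ d) ≡ suc (length xs)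
length-∷ʳ xs d = trans (ListP.length-++ xs) (ℕP.+-comm (length xs) 1)

length-take≤ : ∀ n (xs : DigitSeq) → length (take n xs) ≤ n
length-take≤ n xs = subst (_≤ n) (sym (ListP.length-take n xs)) (ℕP.m⊓n≤m n (length xs))

take-++ : ∀ {n} (xs ys : DigitSeq) → length xs ≡ n → take n (xs ++ ys) ≡ xs
take-++ []       ys refl = refl
take-++ (x ∷ xs) ys refl = cong (x ∷_) (take-++ xs ys refl)

drop-++ : ∀ {n} (xs ys : DigitSeq) → length xs ≡ n → drop n (xs ++ ys) ≡ ys
drop-++ []       ys refl = refl
drop-++ (x ∷ xs) ys refl = drop-++ xs ys refl

digitVal≤1 : ∀ d → digitVal d ℤ.≤ + 1
digitVal≤1 d0  = ℤ.+≤+ z≤n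
digitVal≤1 d1  = ℤ.+≤+ (s≤s z≤n)
digitVal≤1 dm1 = ℤ.-≤+

-1≤digitVal : ∀ d → -[1+ 0 ] ℤ.≤ digitVal d
-1≤digitVal d0  = ℤ.-≤+
-1≤digitVal d1  = ℤ.-≤+
-1≤digitVal dm1 = ℤ.-≤- z≤n

value<two^length : ∀ xs → value xs ℤ.< two^ (length xs)
value<two^length []       = ℤ.+<+ (s≤s z≤n)
value<two^length (x ∷ xs) = subst (value (x ∷ xs) ℤ.<_) (sym (two^-suc (length xs))) (ℤP.suc[i]≤j⇒i<j (begin
  + 1 ℤ.+ (digitVal x ℤ.+ + 2 ℤ.* v) ≤⟨ ℤP.+-monoʳ-≤ (+ 1) (ℤP.+-monoˡ-≤ (+ 2 ℤ.* v) (digitVal≤1 x)) ⟩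
  + 1 ℤ.+ (+ 1 ℤ.+ + 2 ℤ.* v)        ≡⟨ regroup v ⟩
  + 2 ℤ.* (+ 1 ℤ.+ v)                ≤⟨ ℤP.*-monoˡ-≤-nonNeg (+ 2) (ℤP.i<j⇒suc[i]≤j (value<two^length xs)) ⟩
  + 2 ℤ.* two^ (length xs)           ∎))
  where
  open ℤP.≤-Reasoning
  v : ℤ
  v = value xs
  regroup : ∀ v → + 1 ℤ.+ (+ 1 ℤ.+ + 2 ℤ.* v) ≡ + 2 ℤ.* (+ 1 ℤ.+ v)
  regroup = solve-∀

-two^length<value : ∀ xs → ℤ.- two^ (length xs) ℤ.< value xs
-two^length<value []       = ℤ.-<+
-two^length<value (x ∷ xs) = subst (ℤ._< value (x ∷ xs)) (cong ℤ.-_ (sym (two^-suc (length xs)))) (ℤP.suc[i]≤j⇒i<j (begin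
  + 1 ℤ.+ ℤ.- (+ 2 ℤ.* p)                ≡⟨ regroup p ⟩
  -[1+ 0 ] ℤ.+ + 2 ℤ.* (+ 1 ℤ.+ ℤ.- p)    ≤⟨ ℤP.+-monoʳ-≤ -[1+ 0 ] (ℤP.*-monoˡ-≤-nonNeg (+ 2) (ℤP.i<j⇒suc[i]≤j (-two^length<value xs))) ⟩
  -[1+ 0 ] ℤ.+ + 2 ℤ.* value xs          ≤⟨ ℤP.+-monoˡ-≤ (+ 2 ℤ.* value xs) (-1≤digitVal x) ⟩
  digitVal x ℤ.+ + 2 ℤ.* value xs        ∎))
  where
  open ℤP.≤-Reasoning
  p : ℤ
  p = two^ (length xs)
  regroup : ∀ p → + 1 ℤ.+ ℤ.- (+ 2 ℤ.* p) ≡ -[1+ 0 ] ℤ.+ + 2 ℤ.* (+ 1 ℤ.+ ℤ.- p)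
  regroup = solve-∀

value<two^ : ∀ {n} xs → length xs ≤ n → value xs ℤ.< two^ n
value<two^ xs len≤n = ℤP.<-≤-trans (value<two^length xs) (two^-mono-≤ len≤n)

-two^<value : ∀ {n} xs → length xs ≤ n → ℤ.- two^ n ℤ.< value xs
-two^<value xs len≤n = ℤP.≤-<-trans (ℤP.neg-mono-≤ (two^-mono-≤ len≤n)) (-two^length<value xs)

0<value+two^ : ∀ {m} xs → length xs ≤ m → + 0 ℤ.< value xs ℤ.+ two^ m
0<value+two^ {m} xs len≤m = subst (ℤ._< value xs ℤ.+ two^ m) (ℤP.+-inverseˡ (two^ m)) (ℤP.+-monoˡ-< (two^ m) (-two^<value xs len≤m))

-- The lowest digit

2*≢1 : ∀ t → + 2 ℤ.* t ≢ + 1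
2*≢1 (+ n)    eq = ℕP.even≢odd n 0 (ℤP.+-injective (trans (ℤP.pos-* 2 n) eq))
2*≢1 -[1+ n ] ()

2*≢1+2* : ∀ u v → + 2 ℤ.* v ≢ + 1 ℤ.+ + 2 ℤ.* u
2*≢1+2* u v eq = 2*≢1 (v ℤ.- u) (begin
  + 2 ℤ.* (v ℤ.- u)                      ≡⟨ distrib u v ⟩
  + 2 ℤ.* v ℤ.- + 2 ℤ.* u                ≡⟨ cong (ℤ._- + 2 ℤ.* u) eq ⟩
  + 1 ℤ.+ + 2 ℤ.* u ℤ.- + 2 ℤ.* u        ≡⟨ cancel u ⟩
  + 1                                    ∎)
  where
  open ≡-Reasoning
  distrib : ∀ u v → + 2 ℤ.* (v ℤ.- u) ≡ + 2 ℤ.* v ℤ.- + 2 ℤ.* u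
  distrib = solve-∀
  cancel : ∀ u → + 1 ℤ.+ + 2 ℤ.* u ℤ.- + 2 ℤ.* u ≡ + 1
  cancel = solve-∀

2*-injective : ∀ {x y} → + 2 ℤ.* x ≡ + 2 ℤ.* y → x ≡ y
2*-injective {x} {y} = ℤP.*-cancelˡ-≡ (+ 2) x y

rep-even-inv : ∀ {m} e es → IsRep (2 * m) (e ∷ es) → e ≡ d0 × IsRep m es
rep-even-inv {m} d0 es r =
  refl , 2*-injective (trans (sym (ℤP.+-identityˡ _)) (trans r (ℤP.pos-* 2 m)))
rep-even-inv {m} d1 es r = ⊥-elim (2*≢1+2* (value es) (+ m) (trans (sym (ℤP.pos-* 2 m)) (sym r)))
rep-even-inv {m} dm1 es r =
  ⊥-elim (2*≢1+2* (value es ℤ.- + 1) (+ m) (trans (sym (ℤP.pos-* 2 m)) (trans (sym r) (regroup (value es)))))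
  where
  regroup : ∀ v → -[1+ 0 ] ℤ.+ + 2 ℤ.* v ≡ + 1 ℤ.+ + 2 ℤ.* (v ℤ.- + 1)
  regroup = solve-∀

rep-odd-inv : ∀ {m} e es → IsRep (suc (2 * m)) (e ∷ es) →
              (e ≡ d1 × IsRep m es) ⊎ (e ≡ dm1 × IsRep (suc m) es)
rep-odd-inv {m} d0 es r =
  ⊥-elim (2*≢1+2* (+ m) (value es) (trans (sym (ℤP.+-identityˡ _)) (trans r (cong (ℤ._+_ (+ 1)) (ℤP.pos-* 2 m)))))
rep-odd-inv {m} d1 es r = inj₁ (refl , 2*-injective (begin
  + 2 ℤ.* value es                         ≡⟨ drop1 (+ 2 ℤ.* value es) ⟩
  ℤ.- + 1 ℤ.+ (+ 1 ℤ.+ + 2 ℤ.* value es)   ≡⟨ cong (λ x → ℤ.- + 1 ℤ.+ x) (trans r (cong (ℤ._+_ (+ 1)) (ℤP.pos-* 2 m))) ⟩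
  ℤ.- + 1 ℤ.+ (+ 1 ℤ.+ + 2 ℤ.* + m)        ≡⟨ drop1 (+ 2 ℤ.* + m) ⟨
  + 2 ℤ.* + m                              ∎))
  where
  open ≡-Reasoning
  drop1 : ∀ x → x ≡ ℤ.- + 1 ℤ.+ (+ 1 ℤ.+ x)
  drop1 = solve-∀
rep-odd-inv {m} dm1 es r = inj₂ (refl , 2*-injective (begin
  + 2 ℤ.* value es                          ≡⟨ add1 (value es) ⟩
  + 1 ℤ.+ (-[1+ 0 ] ℤ.+ + 2 ℤ.* value es)   ≡⟨ cong (ℤ._+_ (+ 1)) (trans r (cong (ℤ._+_ (+ 1)) (ℤP.pos-* 2 m))) ⟩
  + 1 ℤ.+ (+ 1 ℤ.+ + 2 ℤ.* + m)             ≡⟨ double-suc (+ m) ⟩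
  + 2 ℤ.* + suc m                           ∎))
  where
  open ≡-Reasoning
  add1 : ∀ v → + 2 ℤ.* v ≡ + 1 ℤ.+ (-[1+ 0 ] ℤ.+ + 2 ℤ.* v)
  add1 = solve-∀
  double-suc : ∀ x → + 1 ℤ.+ (+ 1 ℤ.+ + 2 ℤ.* x) ≡ + 2 ℤ.* (+ 1 ℤ.+ x)
  double-suc = solve-∀

rep-∷-even : ∀ {m} es → IsRep m es → IsRep (2 * m) (d0 ∷ es)
rep-∷-even {m} es r = trans (ℤP.+-identityˡ _) (trans (cong (ℤ._*_ (+ 2)) r) (sym (ℤP.pos-* 2 m)))

rep-∷-odd : ∀ {m} es → IsRep m es → IsRep (suc (2 * m)) (d1 ∷ es)
rep-∷-odd {m} es r = cong (ℤ._+_ (+ 1)) (trans (cong (ℤ._*_ (+ 2)) r) (sym (ℤP.pos-* 2 m)))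

rep-∷-odd-borrow : ∀ {m} es → IsRep (suc m) es → IsRep (suc (2 * m)) (dm1 ∷ es)
rep-∷-odd-borrow {m} es r = trans (cong (λ v → -[1+ 0 ] ℤ.+ + 2 ℤ.* v) r)
  (trans (cong (ℤ._+_ -[1+ 0 ]) (sym (ℤP.pos-* 2 (suc m)))) (cong (λ n → -[1+ 0 ] ℤ.+ + n) (ℕP.*-suc 2 m)))

-- Optimal representations, by recursion on n

NoLeadingZero-tail : ∀ e es → NoLeadingZero (e ∷ es) → NoLeadingZero es
NoLeadingZero-tail e []       _  = tt
NoLeadingZero-tail e (f ∷ fs) nz = nz

NoLeadingZero-∷ : ∀ e es → es ≢ [] → NoLeadingZero es → NoLeadingZero (e ∷ es)
NoLeadingZero-∷ e []       es≢[] _  = ⊥-elim (es≢[] refl)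
NoLeadingZero-∷ e (f ∷ fs) _     nz = nz

NoLeadingZero-++ : ∀ xs ys → ys ≢ [] → NoLeadingZero ys → NoLeadingZero (xs ++ ys)
NoLeadingZero-++ []       ys _     nz = nz
NoLeadingZero-++ (x ∷ xs) ys ys≢[] nz =
  NoLeadingZero-∷ x (xs ++ ys) (λ eq → ys≢[] (ListP.++-conicalʳ xs ys eq)) (NoLeadingZero-++ xs ys ys≢[] nz)

NoLeadingZero-drop : ∀ n xs → NoLeadingZero xs → NoLeadingZero (drop n xs)
NoLeadingZero-drop zero    xs       nz = nz
NoLeadingZero-drop (suc n) []       nz = tt
NoLeadingZero-drop (suc n) (x ∷ xs) nz = NoLeadingZero-drop n xs (NoLeadingZero-tail x xs nz)

rep-suc-≢[] : ∀ {n} es → IsRep (suc n) es → es ≢ []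
rep-suc-≢[] [] () refl

weight≡0⇒value≡0 : ∀ es → weight es ≡ 0 → value es ≡ + 0
weight≡0⇒value≡0 []         _  = refl
weight≡0⇒value≡0 (d0 ∷ es)  w0 = cong (λ v → + 0 ℤ.+ + 2 ℤ.* v) (weight≡0⇒value≡0 es w0)

canonical-weight≡0⇒[] : ∀ es → NoLeadingZero es → weight es ≡ 0 → es ≡ []
canonical-weight≡0⇒[] []               _  _  = refl
canonical-weight≡0⇒[] (d0 ∷ [])        nz _  = ⊥-elim (nz refl)
canonical-weight≡0⇒[] (d0 ∷ es@(_ ∷ _)) nz w0 with canonical-weight≡0⇒[] es nz w0
... | ()

CanonicalRep : ℕ → ℕ → DigitSeq → Set
CanonicalRep n w es = NoLeadingZero es × IsRep n es × weight es ≡ w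

record Census (n : ℕ) : Set where
  field
    minWeight : ℕ
    reps      : List DigitSeq
    unique    : Unique reps
    sound     : ∀ {es} → es ∈ reps → CanonicalRep n minWeight es
    complete  : ∀ es → CanonicalRep n minWeight es → es ∈ reps
    minimal   : ∀ fs → IsRep n fs → minWeight ≤ weight fs
    attained  : Σ DigitSeq (CanonicalRep n minWeight)

  optimal⇒minWeight : ∀ es → IsOptRep n es → weight es ≡ minWeight
  optimal⇒minWeight es (_ , r , opt) with attained
  ... | wit , _ , rwit , wwit = ℕP.≤-antisym (subst (weight es ≤_) wwit (opt wit rwit)) (minimal es r)

census⇒ROpt : ∀ {n} (C : Census n) → ROpt n (length (Census.reps C))
census⇒ROpt {n} C = reps , unique , refl , All.tabulate optimal , λ es o@(nz , r , _) → complete es (nz , r , optimal⇒minWeight es o)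
  where
  open Census C
  optimal : ∀ {es} → es ∈ reps → IsOptRep n es
  optimal m with sound m
  ... | nz , r , w = nz , r , λ fs rf → subst (_≤ weight fs) (sym w) (minimal fs rf)

census-0 : Census 0
census-0 = record
  { minWeight = 0
  ; reps      = [] ∷ []
  ; unique    = [] ∷ []
  ; sound     = λ { (here refl) → tt , refl , refl }
  ; complete  = λ es (nz , _ , w0) → here (canonical-weight≡0⇒[] es nz w0)
  ; minimal   = λ _ _ → z≤n
  ; attained  = [] , tt , refl , refl
  }

census-1 : Census 1
census-1 = record
  { minWeight = 1
  ; reps      = (d1 ∷ []) ∷ []
  ; unique    = [] ∷ []
  ; sound     = λ { (here refl) → (λ ()) , refl , refl }
  ; complete  = complete
  ; minimal   = minimal
  ; attained  = d1 ∷ [] , (λ ()) , refl , refl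
  }
  where
  weight≡0⇒¬rep1 : ∀ es → weight es ≡ 0 → ¬ IsRep 1 es
  weight≡0⇒¬rep1 es w0 r with trans (sym (weight≡0⇒value≡0 es w0)) r
  ... | ()
  complete : ∀ es → CanonicalRep 1 1 es → es ∈ (d1 ∷ []) ∷ []
  complete (e ∷ es) (nz , r , w) with rep-odd-inv {0} e es r
  ... | inj₁ (refl , _) = here (cong (d1 ∷_) (canonical-weight≡0⇒[] es (NoLeadingZero-tail d1 es nz) (ℕP.suc-injective w)))
  ... | inj₂ (refl , r′) = ⊥-elim (weight≡0⇒¬rep1 es (ℕP.suc-injective w) r′)
  minimal : ∀ fs → IsRep 1 fs → 1 ≤ weight fs
  minimal fs r with weight fs in w
  ... | zero  = ⊥-elim (weight≡0⇒¬rep1 fs w r)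
  ... | suc _ = s≤s z≤n

census-even : ∀ m → Census (suc m) → Census (2 * suc m)
census-even m C = record
  { minWeight = C.minWeight
  ; reps      = map (d0 ∷_) C.reps
  ; unique    = UniqueP.map⁺ ListP.∷-injectiveʳ C.unique
  ; sound     = sound
  ; complete  = complete
  ; minimal   = minimal
  ; attained  = let es , c = C.attained in d0 ∷ es , extend es c
  }
  where
  module C = Census C
  extend : ∀ es → CanonicalRep (suc m) C.minWeight es → CanonicalRep (2 * suc m) C.minWeight (d0 ∷ es)
  extend es (nz , r , w) = NoLeadingZero-∷ d0 es (rep-suc-≢[] es r) nz , rep-∷-even {suc m} es r , w
  sound : ∀ {es} → es ∈ map (d0 ∷_) C.reps → CanonicalRep (2 * suc m) C.minWeight es
  sound p with ∈-map⁻ (d0 ∷_) p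
  ... | es , q , refl = extend es (C.sound q)
  complete : ∀ es → CanonicalRep (2 * suc m) C.minWeight es → es ∈ map (d0 ∷_) C.reps
  complete (e ∷ es) (nz , r , w) with rep-even-inv {suc m} e es r
  ... | refl , r′ = ∈-map⁺ (d0 ∷_) (C.complete es (NoLeadingZero-tail d0 es nz , r′ , w))
  minimal : ∀ fs → IsRep (2 * suc m) fs → C.minWeight ≤ weight fs
  minimal (e ∷ fs) r with rep-even-inv {suc m} e fs r
  ... | refl , r′ = C.minimal fs r′

-- The lowest digit of a representation of 2m+1 is 1, the rest representing m, or -1, the rest
-- representing m+1; the optimal representations are those of the lighter kind.
census-odd : ∀ m → Census (suc m) → Census (suc (suc m)) → Census (suc (2 * suc m))
census-odd m C₁ C₂ = record
  { minWeight = w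
  ; reps      = filter weight≟w candidates
  ; unique    = UniqueP.filter⁺ weight≟w
                  (UniqueP.++⁺ (UniqueP.map⁺ ListP.∷-injectiveʳ C₁.unique) (UniqueP.map⁺ ListP.∷-injectiveʳ C₂.unique) disjoint)
  ; sound     = sound
  ; complete  = complete
  ; minimal   = minimal
  ; attained  = attained
  }
  where
  module C₁ = Census C₁
  module C₂ = Census C₂
  n w : ℕ
  n = suc (2 * suc m)
  w = suc (C₁.minWeight ⊓ C₂.minWeight)
  candidates : List DigitSeq
  candidates = map (d1 ∷_) C₁.reps ++ map (dm1 ∷_) C₂.reps
  weight≟w : ∀ es → Dec (weight es ≡ w)
  weight≟w es = weight es ℕ.≟ w

  disjoint : ∀ {es} → ¬ (es ∈ map (d1 ∷_) C₁.reps × es ∈ map (dm1 ∷_) C₂.reps)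
  disjoint (p , q) with ∈-map⁻ (d1 ∷_) p | ∈-map⁻ (dm1 ∷_) q
  ... | _ , _ , refl | _ , _ , ()

  extend₁ : ∀ es → CanonicalRep (suc m) C₁.minWeight es → CanonicalRep n (suc C₁.minWeight) (d1 ∷ es)
  extend₁ es (nz , r , wt) = NoLeadingZero-∷ d1 es (rep-suc-≢[] es r) nz , rep-∷-odd {suc m} es r , cong suc wt
  extend₂ : ∀ es → CanonicalRep (suc (suc m)) C₂.minWeight es → CanonicalRep n (suc C₂.minWeight) (dm1 ∷ es)
  extend₂ es (nz , r , wt) = NoLeadingZero-∷ dm1 es (rep-suc-≢[] es r) nz , rep-∷-odd-borrow {suc m} es r , cong suc wt

  sound : ∀ {es} → es ∈ filter weight≟w candidates → CanonicalRep n w es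
  sound p with ∈-filter⁻ weight≟w {xs = candidates} p
  ... | q , wt with ∈-++⁻ (map (d1 ∷_) C₁.reps) q
  ... | inj₁ q₁ with ∈-map⁻ (d1 ∷_) q₁
  ...   | es , q₁′ , refl = let nz , r , _ = extend₁ es (C₁.sound q₁′) in nz , r , wt
  sound p | q , wt | inj₂ q₂ with ∈-map⁻ (dm1 ∷_) q₂
  ...   | es , q₂′ , refl = let nz , r , _ = extend₂ es (C₂.sound q₂′) in nz , r , wt

  complete : ∀ es → CanonicalRep n w es → es ∈ filter weight≟w candidates
  complete (e ∷ es) (nz , r , wt) = ∈-filter⁺ weight≟w candidate wt
    where
    nz′ : NoLeadingZero es
    nz′ = NoLeadingZero-tail e es nz
    candidate : e ∷ es ∈ candidates
    candidate with rep-odd-inv {suc m} e es r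
    ... | inj₁ (refl , r′) = ∈-++⁺ˡ (∈-map⁺ (d1 ∷_) (C₁.complete es (nz′ , r′ ,
            ℕP.≤-antisym (ℕP.≤-trans (ℕP.≤-reflexive (ℕP.suc-injective wt)) (ℕP.m⊓n≤m _ _)) (C₁.minimal es r′))))
    ... | inj₂ (refl , r′) = ∈-++⁺ʳ (map (d1 ∷_) C₁.reps) (∈-map⁺ (dm1 ∷_) (C₂.complete es (nz′ , r′ ,
            ℕP.≤-antisym (ℕP.≤-trans (ℕP.≤-reflexive (ℕP.suc-injective wt)) (ℕP.m⊓n≤n _ _)) (C₂.minimal es r′))))

  minimal : ∀ fs → IsRep n fs → w ≤ weight fs
  minimal (e ∷ fs) r with rep-odd-inv {suc m} e fs r
  ... | inj₁ (refl , r′) = s≤s (ℕP.≤-trans (ℕP.m⊓n≤m _ _) (C₁.minimal fs r′))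
  ... | inj₂ (refl , r′) = s≤s (ℕP.≤-trans (ℕP.m⊓n≤n _ _) (C₂.minimal fs r′))

  attained : Σ DigitSeq (CanonicalRep n w)
  attained with ℕP.⊓-sel C₁.minWeight C₂.minWeight
  ... | inj₁ eq = let es , c = C₁.attained ; nz , r , wt = extend₁ es c in d1 ∷ es , nz , r , trans wt (cong suc (sym eq))
  ... | inj₂ eq = let es , c = C₂.attained ; nz , r , wt = extend₂ es c in dm1 ∷ es , nz , r , trans wt (cong suc (sym eq))

data EvenOdd : ℕ → Set where
  even : ∀ m → EvenOdd (2 * m)
  odd  : ∀ m → EvenOdd (suc (2 * m))

evenOdd : ∀ n → EvenOdd n
evenOdd zero = even 0
evenOdd (suc n) with evenOdd n
... | even m = odd m
... | odd m  = subst EvenOdd (ℕP.*-suc 2 m) (even (suc m))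

census : ∀ n → Census n
census = <-rec Census step
  where
  1+m<2[1+m] : ∀ m → suc m < 2 * suc m
  1+m<2[1+m] m = ℕP.m<m+n (suc m) (s≤s z≤n)
  step : ∀ n → (∀ {k} → k < n → Census k) → Census n
  step n rec with evenOdd n
  ... | even zero    = census-0
  ... | even (suc m) = census-even m (rec (1+m<2[1+m] m))
  ... | odd zero     = census-1
  ... | odd (suc m)  = census-odd m (rec (ℕP.m<n⇒m<1+n (1+m<2[1+m] m))) (rec (s≤s (1+m<2[1+m] m)))

-- Padding, trimming and combining

zeros : ℕ → DigitSeq
zeros n = replicate n d0

value-zeros : ∀ n → value (zeros n) ≡ + 0
value-zeros zero    = refl
value-zeros (suc n) = cong (λ v → + 0 ℤ.+ + 2 ℤ.* v) (value-zeros n)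

weight-zeros : ∀ n → weight (zeros n) ≡ 0
weight-zeros zero    = refl
weight-zeros (suc n) = weight-zeros n

value-++-zeros : ∀ xs n → value (xs ++ zeros n) ≡ value xs
value-++-zeros xs n = trans (value-++ xs (zeros n))
  (trans (cong (λ v → value xs ℤ.+ two^ (length xs) ℤ.* v) (value-zeros n))
         (trans (cong (λ v → value xs ℤ.+ v) (ℤP.*-zeroʳ (two^ (length xs)))) (ℤP.+-identityʳ (value xs))))

weight-++-zeros : ∀ xs n → weight (xs ++ zeros n) ≡ weight xs
weight-++-zeros xs n = trans (weight-++ xs (zeros n)) (trans (cong (_+_ (weight xs)) (weight-zeros n)) (ℕP.+-identityʳ _))

pad : ℕ → DigitSeq → DigitSeq
pad k v = v ++ zeros (k ∸ length v)

length-pad : ∀ k v → length v ≤ k → length (pad k v) ≡ k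
length-pad k v len≤k =
  trans (ListP.length-++ v) (trans (cong (_+_ (length v)) (ListP.length-replicate (k ∸ length v))) (ℕP.m+[n∸m]≡n len≤k))

_∷ᵗ_ : Digit → DigitSeq → DigitSeq
d0 ∷ᵗ [] = []
e  ∷ᵗ es = e ∷ es

trim : DigitSeq → DigitSeq
trim []       = []
trim (e ∷ es) = e ∷ᵗ trim es

trim-canonical : ∀ xs → NoLeadingZero (trim xs)
trim-canonical []       = tt
trim-canonical (e ∷ xs) = canonical-∷ᵗ e (trim xs) (trim-canonical xs)
  where
  canonical-∷ᵗ : ∀ e s → NoLeadingZero s → NoLeadingZero (e ∷ᵗ s)
  canonical-∷ᵗ d0  []      _  = tt
  canonical-∷ᵗ d1  []      _  = λ ()
  canonical-∷ᵗ dm1 []      _  = λ ()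
  canonical-∷ᵗ d0  (_ ∷ _) nz = nz
  canonical-∷ᵗ d1  (_ ∷ _) nz = nz
  canonical-∷ᵗ dm1 (_ ∷ _) nz = nz

trim-canonical-id : ∀ xs → NoLeadingZero xs → trim xs ≡ xs
trim-canonical-id []               _  = refl
trim-canonical-id (d0 ∷ [])        nz = ⊥-elim (nz refl)
trim-canonical-id (d1 ∷ [])        _  = refl
trim-canonical-id (dm1 ∷ [])       _  = refl
trim-canonical-id (e ∷ xs@(_ ∷ _)) nz = trans (cong (e ∷ᵗ_) (trim-canonical-id xs nz)) (∷ᵗ-nonempty e)
  where
  ∷ᵗ-nonempty : ∀ e → e ∷ᵗ xs ≡ e ∷ xs
  ∷ᵗ-nonempty d0  = refl
  ∷ᵗ-nonempty d1  = refl
  ∷ᵗ-nonempty dm1 = refl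

trim-++-zeros : ∀ xs n → trim (xs ++ zeros n) ≡ trim xs
trim-++-zeros []       zero    = refl
trim-++-zeros []       (suc n) = cong (d0 ∷ᵗ_) (trim-++-zeros [] n)
trim-++-zeros (e ∷ xs) n       = cong (e ∷ᵗ_) (trim-++-zeros xs n)

pad-trim : ∀ xs → pad (length xs) (trim xs) ≡ xs
pad-trim []       = refl
pad-trim (e ∷ xs) = pad-∷ᵗ e (trim xs) (pad-trim xs)
  where
  pad-∷ᵗ : ∀ e s → pad (length xs) s ≡ xs → pad (suc (length xs)) (e ∷ᵗ s) ≡ e ∷ xs
  pad-∷ᵗ d0  []      eq = cong (d0 ∷_) eq
  pad-∷ᵗ d0  (_ ∷ _) eq = cong (d0 ∷_) eq
  pad-∷ᵗ d1  s       eq = cong (d1 ∷_) eq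
  pad-∷ᵗ dm1 s       eq = cong (dm1 ∷_) eq

value-trim : ∀ xs → value (trim xs) ≡ value xs
value-trim xs = trans (sym (value-++-zeros (trim xs) _)) (cong value (pad-trim xs))

weight-trim : ∀ xs → weight (trim xs) ≡ weight xs
weight-trim xs = trans (sym (weight-++-zeros (trim xs) _)) (cong weight (pad-trim xs))

-- An empty high part gets no padding, so that canonical arguments give a canonical result.
combine : ℕ → DigitSeq → DigitSeq → DigitSeq
combine k []        v = v
combine k u@(_ ∷ _) v = pad k v ++ u

combine-value : ∀ k u v → length v ≤ k → value (combine k u v) ≡ value v ℤ.+ two^ k ℤ.* value u
combine-value k []        v _     = sym (trans (cong (λ x → value v ℤ.+ x) (ℤP.*-zeroʳ (two^ k))) (ℤP.+-identityʳ (value v)))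
combine-value k u@(_ ∷ _) v len≤k = begin
  value (pad k v ++ u)                                       ≡⟨ value-++ (pad k v) u ⟩
  value (pad k v) ℤ.+ two^ (length (pad k v)) ℤ.* value u    ≡⟨ cong₂ (λ x n → x ℤ.+ two^ n ℤ.* value u) (value-++-zeros v _) (length-pad k v len≤k) ⟩
  value v ℤ.+ two^ k ℤ.* value u                             ∎
  where open ≡-Reasoning

combine-weight : ∀ k u v → weight (combine k u v) ≡ weight v + weight u
combine-weight k []        v = sym (ℕP.+-identityʳ (weight v))
combine-weight k u@(_ ∷ _) v = trans (weight-++ (pad k v) u) (cong (_+ weight u) (weight-++-zeros v _))

combine-canonical : ∀ k u v → NoLeadingZero u → NoLeadingZero v → NoLeadingZero (combine k u v)
combine-canonical k []        v _  nzv = nzv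
combine-canonical k u@(_ ∷ _) v nzu _  = NoLeadingZero-++ (pad k v) u (λ ()) nzu

split : ℕ → DigitSeq → DigitSeq × DigitSeq
split k es = drop k es , trim (take k es)

split-combine : ∀ k u v → length v ≤ k → NoLeadingZero v → split k (combine k u v) ≡ (u , v)
split-combine k [] v len≤k nzv =
  cong₂ _,_ (ListP.drop-all k v len≤k) (trans (cong trim (ListP.take-all k v len≤k)) (trim-canonical-id v nzv))
split-combine k u@(_ ∷ _) v len≤k nzv =
  cong₂ _,_ (drop-++ (pad k v) u (length-pad k v len≤k))
            (trans (cong trim (take-++ (pad k v) u (length-pad k v len≤k))) (trans (trim-++-zeros v _) (trim-canonical-id v nzv)))

combine-split : ∀ k es → NoLeadingZero es → combine k (drop k es) (trim (take k es)) ≡ es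
combine-split k es nz with drop k es in eq
... | [] = trans (cong trim take≡es) (trim-canonical-id es nz)
  where
  take≡es : take k es ≡ es
  take≡es = trans (sym (ListP.++-identityʳ _)) (trans (cong (take k es ++_) (sym eq)) (ListP.take++drop≡id k es))
... | u@(_ ∷ _) = begin
  pad k (trim (take k es)) ++ u                         ≡⟨ cong (λ n → pad n (trim (take k es)) ++ u) (sym (full-take k es eq)) ⟩
  pad (length (take k es)) (trim (take k es)) ++ u      ≡⟨ cong (_++ u) (pad-trim (take k es)) ⟩
  take k es ++ u                                        ≡⟨ cong (take k es ++_) eq ⟨
  take k es ++ drop k es                                ≡⟨ ListP.take++drop≡id k es ⟩
  es                                                    ∎
  where
  open ≡-Reasoning
  full-take : ∀ k (xs : DigitSeq) → drop k xs ≡ u → length (take k xs) ≡ k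
  full-take zero    xs       _  = refl
  full-take (suc k) []       ()
  full-take (suc k) (x ∷ xs) eq = cong suc (full-take k xs eq)

-- The carry from the low digits

ends-with-dm1 : ∀ m X → length X ≤ suc m → value X ℤ.+ two^ m ℤ.≤ + 0 → Σ DigitSeq λ Y → X ≡ Y ∷ʳ dm1 × length Y ≡ m
ends-with-dm1 m X len≤ bound with initLast X
... | [] = ⊥-elim (ℤP.<⇒≱ (0<value+two^ {m} [] z≤n) bound)
... | Y ∷ʳ′ z with ℕP.m≤n⇒m<n∨m≡n (ℕP.≤-pred (subst (_≤ suc m) (length-∷ʳ Y z) len≤))
...   | inj₁ lenY<m = ⊥-elim (ℤP.<⇒≱ (0<value+two^ (Y ∷ʳ z) (subst (_≤ m) (sym (length-∷ʳ Y z)) lenY<m)) bound)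
...   | inj₂ refl = Y , cong (Y ∷ʳ_) (top-digit z bound) , refl
  where
  v p : ℤ
  v = value Y
  p = two^ (length Y)
  top-digit : ∀ z → value (Y ∷ʳ z) ℤ.+ p ℤ.≤ + 0 → z ≡ dm1
  top-digit d0 b = ⊥-elim (ℤP.<⇒≱ (0<value+two^ Y ℕP.≤-refl)
    (subst (ℤ._≤ + 0) (trans (cong (ℤ._+ p) (value-∷ʳ Y d0)) (drop0 v p)) b))
    where
    drop0 : ∀ v p → v ℤ.+ p ℤ.* + 0 ℤ.+ p ≡ v ℤ.+ p
    drop0 = solve-∀
  top-digit d1 b = ⊥-elim (ℤP.<⇒≱ (ℤP.<-≤-trans (0<value+two^ Y ℕP.≤-refl) (ℤP.i≤i+j (v ℤ.+ p) p))
    (subst (ℤ._≤ + 0) (trans (cong (ℤ._+ p) (value-∷ʳ Y d1)) (regroup v p)) b))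
    where
    regroup : ∀ v p → v ℤ.+ p ℤ.* + 1 ℤ.+ p ≡ v ℤ.+ p ℤ.+ p
    regroup = solve-∀
  top-digit dm1 _ = refl

-- The top j digits of X are all -1, and A is what lies below them.
top-digits-dm1 : ∀ {k c} → c ≤ 2 ^ k → ∀ j X → length X ≤ k + j → value X ≡ + c ℤ.- two^ (k + j) →
                 Σ DigitSeq λ A → length A ≤ k × value A ≡ + c ℤ.- two^ k × weight X ≡ j + weight A
top-digits-dm1 {k} {c} _ zero X len val =
  X , subst (length X ≤_) (ℕP.+-identityʳ k) len , subst (λ n → value X ≡ + c ℤ.- two^ n) (ℕP.+-identityʳ k) val , refl
top-digits-dm1 {k} {c} c≤2^k (suc j) X len val = peel (ends-with-dm1 (k + j) X len′ bound)
  where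
  p : ℤ
  p = two^ (k + j)
  two^-k+suc : two^ (k + suc j) ≡ + 2 ℤ.* p
  two^-k+suc = trans (cong two^ (ℕP.+-suc k j)) (two^-suc (k + j))
  len′ : length X ≤ suc (k + j)
  len′ = subst (length X ≤_) (ℕP.+-suc k j) len
  value+p : value X ℤ.+ p ≡ + c ℤ.- p
  value+p = trans (cong (ℤ._+ p) (trans val (cong (λ q → + c ℤ.- q) two^-k+suc))) (halve (+ c) p)
    where
    halve : ∀ c p → c ℤ.- + 2 ℤ.* p ℤ.+ p ≡ c ℤ.- p
    halve = solve-∀
  bound : value X ℤ.+ p ℤ.≤ + 0
  bound = subst (ℤ._≤ + 0) (sym value+p) (ℤP.i≤j⇒i-j≤0 (ℤ.+≤+ (ℕP.≤-trans c≤2^k (ℕP.^-monoʳ-≤ 2 (ℕP.m≤m+n k j)))))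
  value-init : ∀ Y → X ≡ Y ∷ʳ dm1 → length Y ≡ k + j → value Y ≡ + c ℤ.- p
  value-init Y X≡ lenY = begin
    value Y                                  ≡⟨ restore (value Y) (two^ (length Y)) ⟩
    value Y ℤ.+ two^ (length Y) ℤ.* -[1+ 0 ] ℤ.+ two^ (length Y)
                                             ≡⟨ cong (ℤ._+ two^ (length Y)) (value-∷ʳ Y dm1) ⟨
    value (Y ∷ʳ dm1) ℤ.+ two^ (length Y)     ≡⟨ cong₂ (λ Z n → value Z ℤ.+ two^ n) X≡ (sym lenY) ⟨
    value X ℤ.+ p                            ≡⟨ value+p ⟩
    + c ℤ.- p                                ∎
    where
    open ≡-Reasoning
    restore : ∀ v q → v ≡ v ℤ.+ q ℤ.* -[1+ 0 ] ℤ.+ q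
    restore = solve-∀
  peel : (Σ DigitSeq λ Y → X ≡ Y ∷ʳ dm1 × length Y ≡ k + j) →
         Σ DigitSeq λ A → length A ≤ k × value A ≡ + c ℤ.- two^ k × weight X ≡ suc j + weight A
  peel (Y , X≡ , lenY) =
    let A , lenA , valA , wY = top-digits-dm1 c≤2^k j Y (ℕP.≤-reflexive lenY) (value-init Y X≡ lenY)
    in  A , lenA , valA , trans (cong weight X≡) (trans (weight-++ Y (dm1 ∷ [])) (trans (ℕP.+-comm (weight Y) 1) (cong suc wY)))

decrement : ∀ D → Σ DigitSeq λ D′ → value D′ ≡ value D ℤ.- + 1 × weight D′ ≤ suc (weight D)
decrement []        = dm1 ∷ [] , refl , ℕP.≤-refl
decrement (d0 ∷ D)  = dm1 ∷ D , regroup (value D) , ℕP.≤-refl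
  where
  regroup : ∀ v → -[1+ 0 ] ℤ.+ + 2 ℤ.* v ≡ + 0 ℤ.+ + 2 ℤ.* v ℤ.- + 1
  regroup = solve-∀
decrement (d1 ∷ D)  = d0 ∷ D , regroup (value D) , ℕP.m≤n+m (weight D) 2
  where
  regroup : ∀ v → + 0 ℤ.+ + 2 ℤ.* v ≡ + 1 ℤ.+ + 2 ℤ.* v ℤ.- + 1
  regroup = solve-∀
decrement (dm1 ∷ D) = let D′ , val , wt = decrement D in
  d0 ∷ D′ , trans (cong (λ v → + 0 ℤ.+ + 2 ℤ.* v) val) (regroup (value D)) , ℕP.m≤n⇒m≤1+n wt
  where
  regroup : ∀ v → + 0 ℤ.+ + 2 ℤ.* (v ℤ.- + 1) ≡ -[1+ 0 ] ℤ.+ + 2 ℤ.* v ℤ.- + 1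
  regroup = solve-∀

carry∈0,-1 : ∀ {K b} t → b < 2 ^ K → ℤ.- two^ K ℤ.< + b ℤ.+ two^ K ℤ.* t → + b ℤ.+ two^ K ℤ.* t ℤ.< two^ K →
             t ≡ + 0 ⊎ t ≡ -[1+ 0 ]
carry∈0,-1 (+ zero)    _ _ _ = inj₁ refl
carry∈0,-1 -[1+ zero ] _ _ _ = inj₂ refl
carry∈0,-1 {K} {b} (+ suc j) _ _ hi =
  ⊥-elim (ℕP.<⇒≱ (ℤP.drop‿+<+ (subst (ℤ._< two^ K) (sym as-ℕ) hi)) (ℕP.≤-trans (ℕP.m≤m*n (2 ^ K) (suc j)) (ℕP.m≤n+m _ b)))
  where
  as-ℕ : + (b + 2 ^ K * suc j) ≡ + b ℤ.+ two^ K ℤ.* + suc j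
  as-ℕ = trans (ℤP.pos-+ b _) (cong (λ x → + b ℤ.+ x) (ℤP.pos-* (2 ^ K) (suc j)))
carry∈0,-1 {K} {b} -[1+ suc j ] b<2^K lo _ =
  ⊥-elim (ℕP.<⇒≱ b<2^K (ℕP.≤-trans (ℕP.m≤m*n (2 ^ K) (suc j)) (ℕP.<⇒≤ 2^K[1+j]<b)))
  where
  P x : ℤ
  P = two^ K
  x = + suc j
  2^K[1+j]<b : 2 ^ K * suc j < b
  2^K[1+j]<b = ℤP.drop‿+<+ (subst₂ ℤ._<_ (trans (lhs P x) (sym (ℤP.pos-* (2 ^ K) (suc j)))) (rhs (+ b) P x)
                                         (ℤP.+-monoˡ-< (P ℤ.* (+ 1 ℤ.+ x)) lo))
    where
    lhs : ∀ p x → ℤ.- p ℤ.+ p ℤ.* (+ 1 ℤ.+ x) ≡ p ℤ.* x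
    lhs = solve-∀
    rhs : ∀ b p x → b ℤ.+ p ℤ.* ℤ.- (+ 1 ℤ.+ x) ℤ.+ p ℤ.* (+ 1 ℤ.+ x) ≡ b
    rhs = solve-∀

carry-decomposition : ∀ K {n m} es → IsRep (2 ^ K * n + m) es →
                      Σ ℤ λ t → value (take K es) ≡ + m ℤ.+ two^ K ℤ.* t × value (drop K es) ≡ + n ℤ.- t
carry-decomposition K {n} {m} es r = + n ℤ.- W , valT , restore (+ n) W
  where
  open ≡-Reasoning
  P V W : ℤ
  P = two^ K
  V = value (take K es)
  W = value (drop K es)
  restore : ∀ x w → w ≡ x ℤ.- (x ℤ.- w)
  restore = solve-∀
  valT : V ≡ + m ℤ.+ P ℤ.* (+ n ℤ.- W)
  valT = begin
    V                                   ≡⟨ add-sub V W P ⟩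
    V ℤ.+ P ℤ.* W ℤ.- P ℤ.* W           ≡⟨ cong (ℤ._- P ℤ.* W) (value-take-drop K es) ⟨
    value es ℤ.- P ℤ.* W                ≡⟨ cong (ℤ._- P ℤ.* W) (trans r (pos-2^*+ K n m)) ⟩
    P ℤ.* + n ℤ.+ + m ℤ.- P ℤ.* W       ≡⟨ regroup (+ n) (+ m) W P ⟩
    + m ℤ.+ P ℤ.* (+ n ℤ.- W)           ∎
    where
    add-sub : ∀ v w p → v ≡ v ℤ.+ p ℤ.* w ℤ.- p ℤ.* w
    add-sub = solve-∀
    regroup : ∀ n m w p → p ℤ.* n ℤ.+ m ℤ.- p ℤ.* w ≡ m ℤ.+ p ℤ.* (n ℤ.- w)
    regroup = solve-∀

module _ {a b k wa wb : ℕ} (b<2^k : b < 2 ^ k)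
         (minimal-a : ∀ fs → IsRep a fs → wa ≤ weight fs)
         (minimal-b : ∀ fs → IsRep b fs → wb ≤ weight fs) where

  private
    K : ℕ
    K = k + 3
    b<2^K : b < 2 ^ K
    b<2^K = ℕP.<-≤-trans b<2^k (ℕP.^-monoʳ-≤ 2 (ℕP.m≤m+n k 3))

  -- The three top digits of the low part are -1, which costs more than the borrow saves.
  borrow-weight : ∀ es → value (take K es) ≡ + b ℤ.- two^ K → IsRep (suc a) (drop K es) → suc (wa + wb) ≤ weight es
  borrow-weight es valT valD =
    let A , lenA , valA , wT = top-digits-dm1 {k} {b} (ℕP.<⇒≤ b<2^k) 3 (take K es) (length-take≤ K es) valT
        D′ , valD′ , wD′     = decrement D
    in begin
    suc (wa + wb)                          ≤⟨ s≤s (ℕP.+-mono-≤ (ℕP.≤-trans (wa≤ D′ valD′) wD′) (wb≤ A lenA valA)) ⟩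
    suc (suc (weight D) + (weight A + 1))  ≡⟨ regroup (weight D) (weight A) ⟩
    (3 + weight A) + weight D              ≡⟨ cong (_+ weight D) wT ⟨
    weight (take K es) + weight D          ≡⟨ weight-take-drop K es ⟨
    weight es                              ∎
    where
    open ℕP.≤-Reasoning
    D : DigitSeq
    D = drop K es
    wb≤ : ∀ A → length A ≤ k → value A ≡ + b ℤ.- two^ k → wb ≤ weight A + 1
    wb≤ A lenA valA = subst (wb ≤_) (combine-weight k (d1 ∷ []) A) (minimal-b (combine k (d1 ∷ []) A) b-rep)
      where
      add-back : ∀ b p → b ℤ.- p ℤ.+ p ℤ.* + 1 ≡ b
      add-back = solve-∀
      b-rep : IsRep b (combine k (d1 ∷ []) A)
      b-rep = trans (combine-value k (d1 ∷ []) A lenA) (trans (cong (λ v → v ℤ.+ two^ k ℤ.* + 1) valA) (add-back (+ b) (two^ k)))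
    wa≤ : ∀ D′ → value D′ ≡ value D ℤ.- + 1 → wa ≤ weight D′
    wa≤ D′ valD′ = minimal-a D′ (trans valD′ (cong (ℤ._- + 1) valD))
    regroup : ∀ d x → suc (suc d + (x + 1)) ≡ (3 + x) + d
    regroup = ℕSolver.solve-∀

  split-rep : ∀ es → IsRep (2 ^ K * a + b) es → (IsRep b (take K es) × IsRep a (drop K es)) ⊎ suc (wa + wb) ≤ weight es
  split-rep es r with carry-decomposition K es r
  ... | t , valT , valD with carry∈0,-1 {K} {b} t b<2^K (subst (ℤ.- two^ K ℤ.<_) valT (-two^<value (take K es) (length-take≤ K es)))
                                                (subst (ℤ._< two^ K) valT (value<two^ (take K es) (length-take≤ K es)))
  ... | inj₁ refl = inj₁ (trans valT (no-carry (+ b) (two^ K)) , trans valD (ℤP.+-identityʳ (+ a)))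
    where
    no-carry : ∀ b p → b ℤ.+ p ℤ.* + 0 ≡ b
    no-carry = solve-∀
  ... | inj₂ refl = inj₂ (borrow-weight es (trans valT (borrow (+ b) (two^ K))) (trans valD (add-one (+ a))))
    where
    borrow : ∀ b p → b ℤ.+ p ℤ.* -[1+ 0 ] ≡ b ℤ.- p
    borrow = solve-∀
    add-one : ∀ a → a ℤ.- -[1+ 0 ] ≡ + 1 ℤ.+ a
    add-one = solve-∀

-- Split the representation as one of 2^(k+3)·0 + b.
optimal-length : ∀ {b k wb} → b < 2 ^ k → (∀ fs → IsRep b fs → wb ≤ weight fs) →
                 ∀ es → CanonicalRep b wb es → length es ≤ k + 3
optimal-length {b} {k} {wb} b<2^k minimal-b es (nz , r , wt)
  with split-rep {0} {b} {k} {0} {wb} b<2^k (λ _ _ → z≤n) minimal-b es (trans r (cong (λ n → + (n + b)) (sym (ℕP.*-zeroʳ (2 ^ (k + 3))))))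
... | inj₂ heavy = ⊥-elim (ℕP.<⇒≱ heavy (ℕP.≤-reflexive wt))
... | inj₁ (repT , _) = ℕP.m∸n≡0⇒m≤n (trans (sym (ListP.length-drop (k + 3) es)) (cong length drop≡[]))
  where
  weight-drop≡0 : weight (drop (k + 3) es) ≡ 0
  weight-drop≡0 = +-pinned (trans (sym (weight-take-drop (k + 3) es)) (trans wt (sym (ℕP.+-identityʳ wb))))
                           (minimal-b (take (k + 3) es) repT) z≤n .proj₂
  drop≡[] : drop (k + 3) es ≡ []
  drop≡[] = canonical-weight≡0⇒[] _ (NoLeadingZero-drop (k + 3) es nz) weight-drop≡0

-- Multiplicativity

length-cartesianProduct : ∀ {A B : Set} (xs : List A) (ys : List B) → length (cartesianProduct xs ys) ≡ length xs * length ys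
length-cartesianProduct []       ys = refl
length-cartesianProduct (x ∷ xs) ys =
  trans (ListP.length-++ (map (x ,_) ys)) (cong₂ _+_ (ListP.length-map (x ,_) ys) (length-cartesianProduct xs ys))

census-product : ∀ {a b k} → b < 2 ^ k → Census a → Census b → Census (2 ^ (k + 3) * a + b)
census-product {a} {b} {k} b<2^k A B = record
  { minWeight = A.minWeight + B.minWeight
  ; reps      = map combine′ pairs
  ; unique    = UniqueP.map⁻ (subst Unique (sym split∘combine≡id) (UniqueP.cartesianProduct⁺ A.unique B.unique))
  ; sound     = sound
  ; complete  = complete
  ; minimal   = minimal
  ; attained  = let u , cu = A.attained ; v , cv = B.attained in combine K u v , combined {u} {v} cu cv
  }
  where
  module A = Census A
  module B = Census B
  K n : ℕ
  K = k + 3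
  n = 2 ^ K * a + b
  pairs : List (DigitSeq × DigitSeq)
  pairs = cartesianProduct A.reps B.reps
  combine′ : DigitSeq × DigitSeq → DigitSeq
  combine′ = Product.uncurry (combine K)

  combined : ∀ {u v} → CanonicalRep a A.minWeight u → CanonicalRep b B.minWeight v →
             CanonicalRep n (A.minWeight + B.minWeight) (combine K u v)
  combined {u} {v} cu@(nzu , ru , wu) cv@(nzv , rv , wv) =
    combine-canonical K u v nzu nzv ,
    trans (combine-value K u v (optimal-length b<2^k B.minimal v cv)) (value≡ ru rv) ,
    trans (combine-weight K u v) (trans (cong₂ _+_ wv wu) (ℕP.+-comm B.minWeight A.minWeight))
    where
    value≡ : value u ≡ + a → value v ≡ + b → value v ℤ.+ two^ K ℤ.* value u ≡ + n
    value≡ ru rv = trans (cong₂ (λ x y → x ℤ.+ two^ K ℤ.* y) rv ru) (trans (ℤP.+-comm (+ b) (two^ K ℤ.* + a)) (sym (pos-2^*+ K a b)))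

  split∘combine : ∀ {p} → p ∈ pairs → split K (combine′ p) ≡ p
  split∘combine {u , v} p with ∈-cartesianProduct⁻ A.reps B.reps p
  ... | _ , v∈ = let cv@(nzv , _) = B.sound v∈ in split-combine K u v (optimal-length b<2^k B.minimal v cv) nzv

  split∘combine≡id : map (split K) (map combine′ pairs) ≡ pairs
  split∘combine≡id = trans (sym (ListP.map-∘ pairs)) (ListP.map-id-local (All.tabulate split∘combine))

  sound : ∀ {es} → es ∈ map combine′ pairs → CanonicalRep n (A.minWeight + B.minWeight) es
  sound p with ∈-map⁻ combine′ p
  ... | (u , v) , q , refl with ∈-cartesianProduct⁻ A.reps B.reps q
  ...   | u∈ , v∈ = combined {u} {v} (A.sound u∈) (B.sound v∈)

  minimal : ∀ fs → IsRep n fs → A.minWeight + B.minWeight ≤ weight fs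
  minimal fs r with split-rep {a} {b} {k} b<2^k A.minimal B.minimal fs r
  ... | inj₂ heavy = ℕP.<⇒≤ heavy
  ... | inj₁ (repT , repD) = subst (A.minWeight + B.minWeight ≤_)
          (trans (ℕP.+-comm (weight (drop K fs)) (weight (take K fs))) (sym (weight-take-drop K fs)))
          (ℕP.+-mono-≤ (A.minimal (drop K fs) repD) (B.minimal (take K fs) repT))

  complete : ∀ es → CanonicalRep n (A.minWeight + B.minWeight) es → es ∈ map combine′ pairs
  complete es (nz , r , wt) with split-rep {a} {b} {k} b<2^k A.minimal B.minimal es r
  ... | inj₂ heavy = ⊥-elim (ℕP.<⇒≱ heavy (ℕP.≤-reflexive wt))
  ... | inj₁ (repT , repD) = subst (_∈ map combine′ pairs) (combine-split K es nz)
          (∈-map⁺ combine′ (∈-cartesianProduct⁺ (A.complete D (NoLeadingZero-drop K es nz , repD , pinned .proj₁))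
                                                (B.complete (trim T) (trim-canonical T , trans (value-trim T) repT , trans (weight-trim T) (pinned .proj₂)))))
    where
    T D : DigitSeq
    T = take K es
    D = drop K es
    pinned : weight D ≡ A.minWeight × weight T ≡ B.minWeight
    pinned = +-pinned (trans (trans (ℕP.+-comm (weight D) (weight T)) (sym (weight-take-drop K es))) wt) (A.minimal D repD) (B.minimal T repT)

lemma2 : (a b k : ℕ) → b < 2 ^ k →
    Σ ℕ λ x → Σ ℕ λ y → ROpt a x × ROpt b y × ROpt (2 ^ (k + 3) * a + b) (x * y)
lemma2 a b k b<2^k =
  length A.reps , length B.reps , census⇒ROpt (census a) , census⇒ROpt (census b) ,
  subst (ROpt _) count (census⇒ROpt (census-product b<2^k (census a) (census b)))
  where
  module A = Census (census a)
  module B = Census (census b)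
  count : length (Census.reps (census-product b<2^k (census a) (census b))) ≡ length A.reps * length B.reps
  count = trans (ListP.length-map (Product.uncurry (combine (k + 3))) (cartesianProduct A.reps B.reps)) (length-cartesianProduct A.reps B.reps)
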